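{- Let $\phi$ be a $\mathbf{Gr}(\mathbf{K}_{\mathcal{R}^{ -1}_\cap})$-formula in negation normal form. Every sequence of rule applications of the $\mathbf{Gr}(\mathbf{K}_{\mathcal{R}^{ -1}_\cap})$-algorithm starting from the constraint system $\{x_0\models\phi\}$ is finite.
   Context: Let $\overline{\mathcal{R}}=\mathcal{R}\cup\{R^{ -1}:R\in\mathcal{R}\}$ with $(R^{ -1})^{ -1}=R$. Formulae in NNF: $p$, $\neg p$, $\psi_1\wedge\psi_2$, $\psi_1\vee\psi_2$, $\langle\omega\rangle_{\ge n}\psi$, $\langle\omega\rangle_{\le n}\psi$, where $\omega=R_1\cap\dots\cap R_k$ with $R_i\in\overline{\mathcal{R}}$ (identified with the set $\{R_1,\dots,R_k\}$); semantically these say at least / at most $n$ worlds $y$ with $(x,y)\in R_i^\mathfrak{M}$ for all $i$ satisfy $\psi$, where $(R^{ -1})^\mathfrak{M}$ is the converse of $R^\mathfrak{M}$. $\sim\psi$ is the NNF of $\neg\psi$ (De Morgan, $\neg\langle\omega\rangle_{\ge 0}\psi\equiv p\wedge\neg p$, $\neg\langle\omega\rangle_{\ge n}\psi\equiv\langle\omega\rangle_{\le n-1}\psi$ for $n\ge1$, $\neg\langle\omega\rangle_{\le n}\psi\equiv\langle\omega\rangle_{\ge n+1}\psi$). A constraint system (c.s.) $S$ is a finite set of expressions $x\models\psi$ and $Rxy$ ($R\in\overline{\mathcal{R}}$) such that $Rxy\in S$ iff $R^{ -1}yx\in S$; $\sharp\omega^S(x,\psi)$ is the number of $y$ with $\{R_1xy,\dots,R_kxy,y\models\psi\}\subseteq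 S$. The algorithm maintains a relation $\prec_S$ on variables ($x\prec_S y$ iff $y$ was created by the $\ge$-rule for $x$), $\prec_S^+$ its transitive closure. Rules: ($\wedge$) if $x\models\psi_1\wedge\psi_2\in S$ and not both conjunct constraints in $S$, add both; ($\vee$) if $x\models\psi_1\vee\psi_2\in S$ and neither disjunct constraint in $S$, add $x\models\chi$ for a chosen $\chi\in\{\psi_1,\psi_2\}$; (choose) if $x\models\langle\omega\rangle_{\bowtie n}\psi\in S$ ($\bowtie\in\{\le,\ge\}$), and for some $R\in\omega$ there is $y$ with $Rxy\in S$ and $\{y\models\psi,y\models\sim\psi\}\cap S=\emptyset$, then replace $S$ by $S'\cup\{y\models\chi\}$ with $\chi\in\{\psi,\sim\psi\}$ chosen nondeterministically, where $S'$ is $S$ with all constraints mentioning some variable $z$ with $y\prec_S^+z$ removed; ($\ge$) if $x\models\langle\omega\rangle_{\ge n}\psi\in S$, $\sharp\omega^S(x,\psi)<n$, and none of the $\wedge$-, $\vee$-, choose-rules can be applied to a constraint for $x$, then for a fresh $y$ add $y\models\psi$, $y\models\chi_1,\dots,y\models\chi_k$ where $\{\psi_1,\dots,\psi_k\}=\{\psi':x\models\langle\sigma\rangle_{\bowtie m}\psi'\in S$ for some $\sigma,m,\bowtie\}$ and $\chi_i\in\{\psi_i,\sim\psi_i\}$ chosen nondeterministically, and add $R_jxy,R_j^{ -1}yx$ for $j=1,\dots,m$ for a nondeterministically chosen set with $\omega\subseteq\{R_1,\dots,R_m\}\subseteq\overline{\mathcal{R}}$, and set $x\prec_S y$. -}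

module Defs where

open import Data.Nat using (ℕ; zero; suc; _<_)
open import Data.Bool using (Bool; true; false; if_then_else_)
open import Data.Product using (Σ; ∃; _×_; _,_)
open import Data.Sum using (_⊎_)
open import Data.List using (List; []; _∷_; length)
open import Data.List.NonEmpty using (List⁺; toList)
open import Data.List.Membership.Propositional using (_∈_; _∉_)
open import Data.List.Relation.Unary.Unique.Propositional using (Unique)
open import Relation.Binary.PropositionalEquality using (_≡_)
open import Relation.Binary.Construct.Closure.Transitive using (TransClosure)
open import Relation.Nullary using (¬_)
open import Function.Bundles using (_⇔_)

-- Relation symbols: 𝓡 = ℕ; R̄ = 𝓡 ∪ {R⁻¹}

data Role : Set where
  fwd : ℕ → Role
  bwd : ℕ → Role

_⁻¹ : Role → Role
fwd r ⁻¹ = bwd r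
bwd r ⁻¹ = fwd r

-- ω = R₁ ∩ … ∩ Rₖ  (k ≥ 1), identified with the set of its members
Inter : Set
Inter = List⁺ Role

data Formula : Set where
  var  : ℕ → Formula
  nvar : ℕ → Formula
  _∧_  : Formula → Formula → Formula
  _∨_  : Formula → Formula → Formula
  ⟨_⟩≥_∙_ : Inter → ℕ → Formula → Formula
  ⟨_⟩≤_∙_ : Inter → ℕ → Formula → Formula

-- ∼ψ : NNF of ¬ψ  (the falsum p ∧ ¬p uses p = 0)
∼_ : Formula → Formula
∼ var p = nvar p
∼ nvar p = var p
∼ (a ∧ b) = (∼ a) ∨ (∼ b)
∼ (a ∨ b) = (∼ a) ∧ (∼ b)
∼ (⟨ ω ⟩≥ zero ∙ ψ) = var 0 ∧ nvar 0
∼ (⟨ ω ⟩≥ suc n ∙ ψ) = ⟨ ω ⟩≤ n ∙ ψ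
∼ (⟨ ω ⟩≤ n ∙ ψ) = ⟨ ω ⟩≥ suc n ∙ ψ

data Constraint : Set where
  _⊨_ : ℕ → Formula → Constraint
  rel : Role → ℕ → ℕ → Constraint

data Mentions : Constraint → ℕ → Set where
  sat  : ∀ {x ψ} → Mentions (x ⊨ ψ) x
  relˡ : ∀ {R x y} → Mentions (rel R x y) x
  relʳ : ∀ {R x y} → Mentions (rel R x y) y

-- a state of the algorithm: a constraint system (a finite set, given as a
-- list read up to set equality) together with the relation ≺_S (finite set of pairs)
record State : Set where
  constructor ⟪_,_⟫
  field
    cs   : List Constraint
    prec : List (ℕ × ℕ)
open State public

_≺[_]_ : ℕ → State → ℕ → Set
x ≺[ S ] y = (x , y) ∈ prec S

_≺⁺[_]_ : ℕ → State → ℕ → Set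
x ≺⁺[ S ] y = TransClosure (λ a b → a ≺[ S ] b) x y

Counted : State → Inter → ℕ → Formula → ℕ → Set
Counted S ω x ψ k =
  Σ (List ℕ) λ ys → Unique ys × length ys ≡ k ×
    (∀ y → (y ∈ ys) ⇔ (((R : Role) → R ∈ toList ω → rel R x y ∈ cs S) × (y ⊨ ψ) ∈ cs S))

InScope : State → ℕ → Formula → Set
InScope S x ψ' = Σ Inter λ σ → Σ ℕ λ m →
  ((x ⊨ (⟨ σ ⟩≥ m ∙ ψ')) ∈ cs S) ⊎ ((x ⊨ (⟨ σ ⟩≤ m ∙ ψ')) ∈ cs S)

Fresh : State → ℕ → Set
Fresh S y = (∀ c → c ∈ cs S → ¬ Mentions c y) × (∀ a b → (a , b) ∈ prec S → ¬ (a ≡ y) × ¬ (b ≡ y))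

AndApplicable : State → ℕ → Set
AndApplicable S x = Σ Formula λ a → Σ Formula λ b →
  ((x ⊨ (a ∧ b)) ∈ cs S) × ¬ (((x ⊨ a) ∈ cs S) × ((x ⊨ b) ∈ cs S))

OrApplicable : State → ℕ → Set
OrApplicable S x = Σ Formula λ a → Σ Formula λ b →
  ((x ⊨ (a ∨ b)) ∈ cs S) × ((x ⊨ a) ∉ cs S) × ((x ⊨ b) ∉ cs S)

Modal∈ : State → ℕ → Inter → ℕ → Formula → Set
Modal∈ S x ω n ψ = ((x ⊨ (⟨ ω ⟩≥ n ∙ ψ)) ∈ cs S) ⊎ ((x ⊨ (⟨ ω ⟩≤ n ∙ ψ)) ∈ cs S)

ChooseCond : State → ℕ → ℕ → Formula → Set
ChooseCond S x y ψ = Σ Inter λ ω → Σ ℕ λ n → Σ Role λ R →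
  Modal∈ S x ω n ψ × R ∈ toList ω × rel R x y ∈ cs S ×
  ((y ⊨ ψ) ∉ cs S) × ((y ⊨ (∼ ψ)) ∉ cs S)

ChooseApplicable : State → ℕ → Set
ChooseApplicable S x = Σ ℕ λ y → Σ Formula λ ψ → ChooseCond S x y ψ

-- One rule application  S ⟶ T   (T given up to set equality)

data Step (S T : State) : Set where
  ∧-rule : (x : ℕ) (a b : Formula) →
    (x ⊨ (a ∧ b)) ∈ cs S → ¬ (((x ⊨ a) ∈ cs S) × ((x ⊨ b) ∈ cs S)) →
    (∀ c → (c ∈ cs T) ⇔ ((c ∈ cs S) ⊎ (c ≡ (x ⊨ a)) ⊎ (c ≡ (x ⊨ b)))) →
    (∀ p → (p ∈ prec T) ⇔ (p ∈ prec S)) →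
    Step S T
  ∨-rule : (x : ℕ) (a b χ : Formula) →
    (x ⊨ (a ∨ b)) ∈ cs S → (x ⊨ a) ∉ cs S → (x ⊨ b) ∉ cs S →
    (χ ≡ a ⊎ χ ≡ b) →
    (∀ c → (c ∈ cs T) ⇔ ((c ∈ cs S) ⊎ (c ≡ (x ⊨ χ)))) →
    (∀ p → (p ∈ prec T) ⇔ (p ∈ prec S)) →
    Step S T
  choose-rule : (x y : ℕ) (ψ χ : Formula) →
    ChooseCond S x y ψ →
    (χ ≡ ψ ⊎ χ ≡ (∼ ψ)) →
    (∀ c → (c ∈ cs T) ⇔
      (((c ∈ cs S) × ¬ (Σ ℕ λ z → Mentions c z × y ≺⁺[ S ] z)) ⊎ (c ≡ (y ⊨ χ)))) →
    (∀ a b → ((a , b) ∈ prec T) ⇔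
      (((a , b) ∈ prec S) × ¬ (y ≺⁺[ S ] a) × ¬ (y ≺⁺[ S ] b))) →
    Step S T
  ≥-rule : (x : ℕ) (ω : Inter) (n : ℕ) (ψ : Formula) →
    (x ⊨ (⟨ ω ⟩≥ n ∙ ψ)) ∈ cs S →
    (Σ ℕ λ k → Counted S ω x ψ k × k < n) →
    ¬ AndApplicable S x → ¬ OrApplicable S x → ¬ ChooseApplicable S x →
    (y : ℕ) → Fresh S y →
    (ch : Formula → Bool) →        -- choice χᵢ ∈ {ψᵢ, ∼ψᵢ} for each ψᵢ
    (Rs : List Role) → (∀ R → R ∈ toList ω → R ∈ Rs) →
    (∀ c → (c ∈ cs T) ⇔
      ((c ∈ cs S) ⊎ (c ≡ (y ⊨ ψ))
       ⊎ (Σ Formula λ ψ' → InScope S x ψ' × c ≡ (y ⊨ (if ch ψ' then ψ' else ∼ ψ')))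
       ⊎ (Σ Role λ R → R ∈ Rs × (c ≡ rel R x y ⊎ c ≡ rel (R ⁻¹) y x)))) →
    (∀ p → (p ∈ prec T) ⇔ ((p ∈ prec S) ⊎ p ≡ (x , y))) →
    Step S T

initial : Formula → State
initial φ = ⟪ (0 ⊨ φ) ∷ [] , [] ⟫

InfiniteRun : State → Set
InfiniteRun S = Σ (ℕ → State) λ f → f 0 ≡ S × (∀ i → Step (f i) (f (suc i)))

{-# OPTIONS --safe #-}
-- Give each variable z an address ad z: the list of slots (⟨ ω ⟩≥ n ∙ ψ , i), i < n, met on
-- the ≺-path from x₀ to z. Labelled variables get distinct addresses, so the labels z ⊨ ψ of a
-- system become pairs (ad z , ψ) ranging over a finite universe: ψ lies in the closure of φ
-- under subformulas and ∼ of modal scopes, and md ψ + |ad z| ≤ md φ. Every rule adds a new pair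
-- at some depth L and removes only pairs deeper than L (choose prunes just the ≺⁺-descendants
-- of y; the ≥-rule finds a free slot i < n by pigeonhole, as fewer than n successors are
-- counted), so the vector counting the unrealised pairs at each depth 0, …, md φ decreases
-- lexicographically.
module Submission where

open import Defs

open import Data.Bool using (Bool; true; false; if_then_else_)
open import Data.Empty using (⊥; ⊥-elim)
open import Data.Fin using (Fin; toℕ)
open import Data.Fin.Properties using (any?; pigeonhole; toℕ<n)
open import Data.List using (List; []; _∷_; _++_; length; map; concatMap; lookup; upTo; cartesianProduct; cartesianProductWith)
open import Data.List.NonEmpty using (toList) renaming (_∷_ to _∷⁺_)
open import Data.List.Membership.Propositional using (_∈_; _∉_)
open import Data.List.Membership.Propositional.Properties using (∈-++⁺ˡ; ∈-++⁺ʳ; ∈-map⁺; ∈-concat⁺′; ∈-upTo⁺; ∈-cartesianProductWith⁺; ∈-cartesianProductWith⁻; ∈-cartesianProduct⁺; ∈-cartesianProduct⁻)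
open import Data.List.Properties using (∷-injective; ∷-injectiveˡ) renaming (≡-dec to ≡-dec-List)
open import Data.List.Relation.Binary.Subset.Propositional using (_⊆_)
open import Data.List.Relation.Unary.All as All using (All; []; _∷_)
open import Data.List.Relation.Unary.All.Properties using () renaming (++⁺ to All-++⁺)
open import Data.List.Relation.Unary.Any as Any using (Any; here; there)
open import Data.List.Relation.Unary.Any.Properties using (lookup-index)
open import Data.Nat using (ℕ; zero; suc; _+_; _≤_; _<_; _⊔_; z≤n; s≤s; _≟_)
open import Data.Nat.Induction using (<-wellFounded)
open import Data.Nat.Properties using (≤-refl; ≤-reflexive; ≤-trans; <-trans; <-irrefl; <⇒≤; m≤m⊔n; m≤n⊔m; m≤n+m; m≤n⇒m≤1+n; n≤1+n; +-suc; +-monoˡ-≤; +-monoʳ-≤; <⇒≱; +-identityʳ; ≤-antisym; ⊔-mono-≤)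
open import Data.Product using (Σ; ∃; _×_; _,_; proj₁; proj₂; uncurry)
open import Data.Product.Properties using (,-injectiveʳ) renaming (≡-dec to ≡-dec-×)
open import Data.Sum using (_⊎_; inj₁; inj₂; [_,_])
import Data.Sum
open import Data.Vec using (Vec; []; _∷_)
open import Data.Vec.Relation.Binary.Lex.Strict using (Lex-<; this; next) renaming (<-wellFounded to Lex-wellFounded)
open import Function using (_∘_; id)
open import Function.Bundles using (_⇔_; module Equivalence)
open import Induction.WellFounded using (WellFounded; Acc; acc)
open import Relation.Binary.Construct.Closure.Transitive as TransClosure using (_∷_; _∷ʳ_)
open import Relation.Binary.Definitions using (DecidableEquality)
open import Relation.Binary.PropositionalEquality using (_≡_; refl; sym; trans; cong; cong₂; subst)
open import Relation.Nullary using (¬_; Dec; yes; no; ¬?)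
open import Relation.Nullary.Decidable using (map′; _×-dec_; decidable-stable)

open Equivalence using (to; from)

_≟ʳ_ : DecidableEquality Role
fwd m ≟ʳ fwd n = map′ (cong fwd) (λ { refl → refl }) (m ≟ n)
fwd _ ≟ʳ bwd _ = no λ ()
bwd _ ≟ʳ fwd _ = no λ ()
bwd m ≟ʳ bwd n = map′ (cong bwd) (λ { refl → refl }) (m ≟ n)

_≟ⁱ_ : DecidableEquality Inter
(R ∷⁺ Rs) ≟ⁱ (Q ∷⁺ Qs) =
  map′ (uncurry (cong₂ _∷⁺_)) (λ { refl → refl , refl }) ((R ≟ʳ Q) ×-dec ≡-dec-List _≟ʳ_ Rs Qs)

constructorIndex : Formula → ℕ
constructorIndex (var _) = 0
constructorIndex (nvar _) = 1
constructorIndex (_ ∧ _) = 2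
constructorIndex (_ ∨ _) = 3
constructorIndex (⟨ _ ⟩≥ _ ∙ _) = 4
constructorIndex (⟨ _ ⟩≤ _ ∙ _) = 5

_≟ᶠ_ : DecidableEquality Formula
≟ᶠ-sameConstructor : ∀ a b → constructorIndex a ≡ constructorIndex b → Dec (a ≡ b)

a ≟ᶠ b with constructorIndex a ≟ constructorIndex b
... | yes same = ≟ᶠ-sameConstructor a b same
... | no differ = no (differ ∘ cong constructorIndex)

≟ᶠ-sameConstructor (var m) (var n) refl = map′ (cong var) (λ { refl → refl }) (m ≟ n)
≟ᶠ-sameConstructor (nvar m) (nvar n) refl = map′ (cong nvar) (λ { refl → refl }) (m ≟ n)
≟ᶠ-sameConstructor (a ∧ b) (c ∧ d) refl =
  map′ (uncurry (cong₂ _∧_)) (λ { refl → refl , refl }) ((a ≟ᶠ c) ×-dec (b ≟ᶠ d))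
≟ᶠ-sameConstructor (a ∨ b) (c ∨ d) refl =
  map′ (uncurry (cong₂ _∨_)) (λ { refl → refl , refl }) ((a ≟ᶠ c) ×-dec (b ≟ᶠ d))
≟ᶠ-sameConstructor (⟨ ω ⟩≥ m ∙ a) (⟨ σ ⟩≥ n ∙ b) refl =
  map′ (λ { (refl , refl , refl) → refl }) (λ { refl → refl , refl , refl })
       ((ω ≟ⁱ σ) ×-dec (m ≟ n) ×-dec (a ≟ᶠ b))
≟ᶠ-sameConstructor (⟨ ω ⟩≤ m ∙ a) (⟨ σ ⟩≤ n ∙ b) refl =
  map′ (λ { (refl , refl , refl) → refl }) (λ { refl → refl , refl , refl })
       ((ω ≟ⁱ σ) ×-dec (m ≟ n) ×-dec (a ≟ᶠ b))

_≟ᶜ_ : DecidableEquality Constraint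
(x ⊨ a) ≟ᶜ (y ⊨ b) =
  map′ (uncurry (cong₂ _⊨_)) (λ { refl → refl , refl }) ((x ≟ y) ×-dec (a ≟ᶠ b))
(_ ⊨ _) ≟ᶜ rel _ _ _ = no λ ()
rel _ _ _ ≟ᶜ (_ ⊨ _) = no λ ()
rel R x y ≟ᶜ rel Q u v =
  map′ (λ { (refl , refl , refl) → refl }) (λ { refl → refl , refl , refl })
       ((R ≟ʳ Q) ×-dec (x ≟ u) ×-dec (y ≟ v))

open import Data.List.Membership.DecPropositional _≟ᶜ_ using (_∈?_)

md : Formula → ℕ
md (var _) = 0
md (nvar _) = 0
md (a ∧ b) = md a ⊔ md b
md (a ∨ b) = md a ⊔ md b
md (⟨ _ ⟩≥ _ ∙ a) = suc (md a)
md (⟨ _ ⟩≤ _ ∙ a) = suc (md a)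

md-∼ : ∀ a → md (∼ a) ≤ md a
md-∼ (var _) = ≤-refl
md-∼ (nvar _) = ≤-refl
md-∼ (a ∧ b) = ⊔-mono-≤ (md-∼ a) (md-∼ b)
md-∼ (a ∨ b) = ⊔-mono-≤ (md-∼ a) (md-∼ b)
md-∼ (⟨ _ ⟩≥ zero ∙ _) = z≤n
md-∼ (⟨ _ ⟩≥ suc _ ∙ _) = ≤-refl
md-∼ (⟨ _ ⟩≤ _ ∙ _) = ≤-refl

data Component : Formula → Formula → Set where
  ∧ˡ : ∀ {a b} → Component a (a ∧ b)
  ∧ʳ : ∀ {a b} → Component b (a ∧ b)
  ∨ˡ : ∀ {a b} → Component a (a ∨ b)
  ∨ʳ : ∀ {a b} → Component b (a ∨ b)

data ScopeOf (ψ : Formula) : Formula → Set where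
  ≥-scope : ∀ {ω n} → ScopeOf ψ (⟨ ω ⟩≥ n ∙ ψ)
  ≤-scope : ∀ {ω n} → ScopeOf ψ (⟨ ω ⟩≤ n ∙ ψ)

md-component : ∀ {χ θ} → Component χ θ → md χ ≤ md θ
md-component (∧ˡ {a} {b}) = m≤m⊔n (md a) (md b)
md-component (∧ʳ {a} {b}) = m≤n⊔m (md a) (md b)
md-component (∨ˡ {a} {b}) = m≤m⊔n (md a) (md b)
md-component (∨ʳ {a} {b}) = m≤n⊔m (md a) (md b)

md-scope : ∀ {ψ θ} → ScopeOf ψ θ → md θ ≡ suc (md ψ)
md-scope ≥-scope = refl
md-scope ≤-scope = refl

sub proper : Formula → List Formula
sub a = a ∷ proper a
proper (var _) = []
proper (nvar _) = []
proper (a ∧ b) = sub a ++ sub b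
proper (a ∨ b) = sub a ++ sub b
proper (⟨ _ ⟩≥ _ ∙ a) = sub a
proper (⟨ _ ⟩≤ _ ∙ a) = sub a

infix 4 _⊑_
_⊑_ : Formula → Formula → Set
a ⊑ b = a ∈ sub b

⊑-refl : ∀ {a} → a ⊑ a
⊑-refl = here refl

sub-closed : ∀ c → All (λ b → sub b ⊆ sub c) (sub c)
sub-closed c = id ∷ proper-closed c
  where
  proper-closed : ∀ c → All (λ b → sub b ⊆ sub c) (proper c)
  proper-closed (var _) = []
  proper-closed (nvar _) = []
  proper-closed (a ∧ b) = All-++⁺ (All.map (λ h {_} p → there (∈-++⁺ˡ (h p))) (sub-closed a))
                                  (All.map (λ h {_} p → there (∈-++⁺ʳ (sub a) (h p))) (sub-closed b))
  proper-closed (a ∨ b) = All-++⁺ (All.map (λ h {_} p → there (∈-++⁺ˡ (h p))) (sub-closed a))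
                                  (All.map (λ h {_} p → there (∈-++⁺ʳ (sub a) (h p))) (sub-closed b))
  proper-closed (⟨ _ ⟩≥ _ ∙ a) = All.map (λ h {_} p → there (h p)) (sub-closed a)
  proper-closed (⟨ _ ⟩≤ _ ∙ a) = All.map (λ h {_} p → there (h p)) (sub-closed a)

⊑-trans : ∀ {a b c} → a ⊑ b → b ⊑ c → a ⊑ c
⊑-trans {c = c} a⊑b b⊑c = All.lookup (sub-closed c) b⊑c a⊑b

component-⊑ : ∀ {χ θ} → Component χ θ → χ ⊑ θ
component-⊑ ∧ˡ = there (∈-++⁺ˡ ⊑-refl)
component-⊑ (∧ʳ {a}) = there (∈-++⁺ʳ (sub a) ⊑-refl)
component-⊑ ∨ˡ = there (∈-++⁺ˡ ⊑-refl)
component-⊑ (∨ʳ {a}) = there (∈-++⁺ʳ (sub a) ⊑-refl)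

scope-⊑ : ∀ {ψ θ} → ScopeOf ψ θ → ψ ⊑ θ
scope-⊑ ≥-scope = there ⊑-refl
scope-⊑ ≤-scope = there ⊑-refl

ScopesBelow : Formula → Formula → Set
ScopesBelow c θ = ∀ {ψ} → ScopeOf ψ θ → ψ ⊑ c

scopesBelow-⊑ : ∀ {c c' θs} → c ⊑ c' → All (ScopesBelow c) θs → All (ScopesBelow c') θs
scopesBelow-⊑ c⊑c' = All.map (λ h {_} s → ⊑-trans (h s) c⊑c')

-- Negation only rearranges the propositional structure above the modalities,
-- so the modalities occurring in ∼ c still have their scopes in c.
∼-scopes : ∀ c → All (ScopesBelow c) (sub (∼ c))
∼-scopes (var _) = (λ ()) ∷ []
∼-scopes (nvar _) = (λ ()) ∷ []
∼-scopes (a ∧ b) =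
  (λ ()) ∷ All-++⁺ (scopesBelow-⊑ (component-⊑ ∧ˡ) (∼-scopes a))
                   (scopesBelow-⊑ (component-⊑ ∧ʳ) (∼-scopes b))
∼-scopes (a ∨ b) =
  (λ ()) ∷ All-++⁺ (scopesBelow-⊑ (component-⊑ ∨ˡ) (∼-scopes a))
                   (scopesBelow-⊑ (component-⊑ ∨ʳ) (∼-scopes b))
∼-scopes (⟨ _ ⟩≥ zero ∙ _) = (λ ()) ∷ (λ ()) ∷ (λ ()) ∷ []
∼-scopes (⟨ _ ⟩≥ suc _ ∙ a) =
  (λ { ≤-scope → scope-⊑ ≥-scope }) ∷
  All.tabulate (λ θ⊑a {_} s → ⊑-trans (scope-⊑ s) (there θ⊑a))
∼-scopes (⟨ _ ⟩≤ _ ∙ a) =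
  (λ { ≥-scope → scope-⊑ ≤-scope }) ∷
  All.tabulate (λ θ⊑a {_} s → ⊑-trans (scope-⊑ s) (there θ⊑a))

data Cl (φ : Formula) (ψ : Formula) : Set where
  sub∈ : ψ ⊑ φ → Cl φ ψ
  ∼sub∈ : ∀ {c} → c ⊑ φ → ψ ⊑ ∼ c → Cl φ ψ

Cl-∼ : ∀ {φ ψ} → ψ ⊑ φ → Cl φ (∼ ψ)
Cl-∼ ψ⊑φ = ∼sub∈ ψ⊑φ ⊑-refl

Cl-component : ∀ {φ χ θ} → Component χ θ → Cl φ θ → Cl φ χ
Cl-component k (sub∈ θ⊑φ) = sub∈ (⊑-trans (component-⊑ k) θ⊑φ)
Cl-component k (∼sub∈ c⊑φ θ⊑∼c) = ∼sub∈ c⊑φ (⊑-trans (component-⊑ k) θ⊑∼c)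

Cl-scope : ∀ {φ ψ θ} → ScopeOf ψ θ → Cl φ θ → ψ ⊑ φ
Cl-scope s (sub∈ θ⊑φ) = ⊑-trans (scope-⊑ s) θ⊑φ
Cl-scope s (∼sub∈ {c} c⊑φ θ⊑∼c) = ⊑-trans (All.lookup (∼-scopes c) θ⊑∼c s) c⊑φ

if-choice : ∀ b ψ → (if b then ψ else ∼ ψ) ≡ ψ ⊎ (if b then ψ else ∼ ψ) ≡ ∼ ψ
if-choice true _ = inj₁ refl
if-choice false _ = inj₂ refl

closure : Formula → List Formula
closure φ = sub φ ++ concatMap (sub ∘ ∼_) (sub φ)

Cl⇒∈closure : ∀ {φ ψ} → Cl φ ψ → ψ ∈ closure φ
Cl⇒∈closure (sub∈ ψ⊑φ) = ∈-++⁺ˡ ψ⊑φ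
Cl⇒∈closure {φ} (∼sub∈ c⊑φ ψ⊑∼c) =
  ∈-++⁺ʳ (sub φ) (∈-concat⁺′ ψ⊑∼c (∈-map⁺ (sub ∘ ∼_) c⊑φ))

infix 4 _<ₗₑₓ_
_<ₗₑₓ_ : ∀ {k} → Vec ℕ k → Vec ℕ k → Set
_<ₗₑₓ_ = Lex-< _≡_ _<_

<ₗₑₓ-wellFounded : ∀ {k} → WellFounded (_<ₗₑₓ_ {k})
<ₗₑₓ-wellFounded = Lex-wellFounded trans (λ { refl p → p }) <-wellFounded

profile : (k : ℕ) → (ℕ → ℕ) → Vec ℕ k
profile zero f = []
profile (suc k) f = f 0 ∷ profile k (f ∘ suc)

profile-<ₗₑₓ : ∀ {k f g} L → L < k → (∀ j → j < L → g j ≡ f j) → g L < f L →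
  profile k g <ₗₑₓ profile k f
profile-<ₗₑₓ {suc k} zero _ _ gL<fL = this gL<fL refl
profile-<ₗₑₓ {suc k} (suc L) (s≤s L<k) agree gL<fL =
  next (agree 0 (s≤s z≤n)) (profile-<ₗₑₓ L L<k (λ j j<L → agree (suc j) (s≤s j<L)) gL<fL)

no-infinite-descent : ∀ {A : Set} {_≺_ : A → A → Set} → WellFounded _≺_ → (P : ℕ → A → Set) →
  (∀ {i a} → P i a → ∃ λ b → P (suc i) b × b ≺ a) → ∀ {a} → ¬ P 0 a
no-infinite-descent {_≺_ = _≺_} wf P descend {a} = go (wf a)
  where
  go : ∀ {i a} → Acc _≺_ a → ¬ P i a
  go (acc rs) p with b , q , b≺a ← descend p = go (rs b≺a) q

module Missing {A : Set} (_≟_ : DecidableEquality A) where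

  missing : List A → List A → ℕ
  missing [] I = 0
  missing (u ∷ U) I with Any.any? (u ≟_) I
  ... | yes _ = missing U I
  ... | no _ = suc (missing U I)

  _⊆_on_ : List A → List A → List A → Set
  I ⊆ J on U = ∀ {u} → u ∈ U → u ∈ I → u ∈ J

  missing-mono : ∀ U {I J} → I ⊆ J on U → missing U J ≤ missing U I
  missing-mono [] _ = z≤n
  missing-mono (u ∷ U) {I} {J} I⊆J with Any.any? (u ≟_) I | Any.any? (u ≟_) J
  ... | yes _ | yes _ = missing-mono U (I⊆J ∘ there)
  ... | yes u∈I | no u∉J = ⊥-elim (u∉J (I⊆J (here refl) u∈I))
  ... | no _ | yes _ = m≤n⇒m≤1+n (missing-mono U (I⊆J ∘ there))
  ... | no _ | no _ = s≤s (missing-mono U (I⊆J ∘ there))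

  missing-< : ∀ U {I J u} → I ⊆ J on U → u ∈ U → u ∈ J → u ∉ I → missing U J < missing U I
  missing-< (v ∷ U) {I} {J} I⊆J u∈U u∈J u∉I with Any.any? (v ≟_) I | Any.any? (v ≟_) J | u∈U
  ... | yes v∈I | no v∉J | _ = ⊥-elim (v∉J (I⊆J (here refl) v∈I))
  ... | yes v∈I | yes _ | here refl = ⊥-elim (u∉I v∈I)
  ... | yes _ | yes _ | there u∈U′ = missing-< U (I⊆J ∘ there) u∈U′ u∈J u∉I
  ... | no _ | no v∉J | here refl = ⊥-elim (v∉J u∈J)
  ... | no _ | no _ | there u∈U′ = s≤s (missing-< U (I⊆J ∘ there) u∈U′ u∈J u∉I)
  ... | no _ | yes _ | here refl = s≤s (missing-mono U (I⊆J ∘ there))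
  ... | no _ | yes _ | there u∈U′ = m≤n⇒m≤1+n (missing-< U (I⊆J ∘ there) u∈U′ u∈J u∉I)

  missing-cong : ∀ U {I J} → I ⊆ J on U → J ⊆ I on U → missing U J ≡ missing U I
  missing-cong U I⊆J J⊆I = ≤-antisym (missing-mono U I⊆J) (missing-mono U J⊆I)

lists : ∀ {A : Set} → ℕ → List A → List (List A)
lists zero xs = [] ∷ []
lists (suc d) xs = cartesianProductWith _∷_ xs (lists d xs)

∈-lists⁺ : ∀ {A : Set} {xs ys : List A} → All (_∈ xs) ys → ys ∈ lists (length ys) xs
∈-lists⁺ [] = here refl
∈-lists⁺ (y∈xs ∷ ys⊆xs) = ∈-cartesianProductWith⁺ _∷_ y∈xs (∈-lists⁺ ys⊆xs)

∈-lists⁻ : ∀ {A : Set} d {xs ys : List A} → ys ∈ lists d xs → length ys ≡ d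
∈-lists⁻ zero (here refl) = refl
∈-lists⁻ (suc d) {xs} ys∈
  with _ , _ , _ , zs∈ , refl ← ∈-cartesianProductWith⁻ _∷_ xs (lists d xs) ys∈ =
  cong suc (∈-lists⁻ d zs∈)

unoccupied-index : ∀ {A : Set} {n} (Occupies : ℕ → A → Set) → (∀ i a → Dec (Occupies i a)) →
  (∀ {i j a} → Occupies i a → Occupies j a → i ≡ j) →
  (ys : List A) → length ys < n → ∃ λ i → i < n × ¬ Any (Occupies i) ys
unoccupied-index {n = n} Occupies occupies? functional ys |ys|<n
  with any? (λ (i : Fin n) → ¬? (Any.any? (occupies? (toℕ i)) ys))
... | yes (i , free) = toℕ i , toℕ<n i , free
... | no none = ⊥-elim (collision (pigeonhole |ys|<n (Any.index ∘ occupant)))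
  where
  occupant : ∀ (i : Fin n) → Any (Occupies (toℕ i)) ys
  occupant i = decidable-stable (Any.any? (occupies? (toℕ i)) ys) (λ free → none (i , free))
  collision : ∃ (λ i → ∃ λ j → i Data.Fin.< j × Any.index (occupant i) ≡ Any.index (occupant j)) → ⊥
  collision (i , j , i<j , same) = <-irrefl (functional (lookup-index (occupant i)) occupies-j) i<j
    where
    occupies-j : Occupies (toℕ j) (lookup ys (Any.index (occupant i)))
    occupies-j = subst (Occupies (toℕ j) ∘ lookup ys) (sym same) (lookup-index (occupant j))

_[_≔_] : ∀ {A : Set} → (ℕ → A) → ℕ → A → ℕ → A
(f [ y ≔ a ]) z with z ≟ y
... | yes _ = a
... | no _ = f z

[≔]-here : ∀ {A : Set} (f : ℕ → A) y a → (f [ y ≔ a ]) y ≡ a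
[≔]-here f y a with y ≟ y
... | yes _ = refl
... | no y≢y = ⊥-elim (y≢y refl)

[≔]-elsewhere : ∀ {A : Set} (f : ℕ → A) {y z} a → ¬ z ≡ y → (f [ y ≔ a ]) z ≡ f z
[≔]-elsewhere f {y} {z} a z≢y with z ≟ y
... | yes z≡y = ⊥-elim (z≢y z≡y)
... | no _ = refl

Slot : Set
Slot = Formula × ℕ

Address : Set
Address = List Slot

_≟ₐ_ : DecidableEquality Address
_≟ₐ_ = ≡-dec-List (≡-dec-× _≟ᶠ_ _≟_)

slotsOf : Formula → List Slot
slotsOf θ@(⟨ _ ⟩≥ n ∙ _) = map (θ ,_) (upTo n)
slotsOf _ = []

Labelled : State → ℕ → Set
Labelled S z = ∃ λ ψ → (z ⊨ ψ) ∈ cs S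

LabelledAt : State → (ℕ → Address) → Address → Formula → Set
LabelledAt S ad a ψ = ∃ λ z → (z ⊨ ψ) ∈ cs S × ad z ≡ a

MentionsSome : (ℕ → Set) → Constraint → Set
MentionsSome P c = ∃ λ z → Mentions c z × P z

mentions-⊨ : ∀ {P : ℕ → Set} {z ψ} → MentionsSome P (z ⊨ ψ) → P z
mentions-⊨ (_ , sat , p) = p

mentions-rel : ∀ {P : ℕ → Set} {R a b} → MentionsSome P (rel R a b) → P a ⊎ P b
mentions-rel (_ , relˡ , p) = inj₁ p
mentions-rel (_ , relʳ , p) = inj₂ p

labels : (ℕ → Address) → List Constraint → List (Address × Formula)
labels ad [] = []
labels ad ((z ⊨ ψ) ∷ cs) = (ad z , ψ) ∷ labels ad cs
labels ad (rel _ _ _ ∷ cs) = labels ad cs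

∈-labels⁺ : ∀ {ad z ψ} {cs : List Constraint} → (z ⊨ ψ) ∈ cs → (ad z , ψ) ∈ labels ad cs
∈-labels⁺ {cs = (_ ⊨ _) ∷ _} (here refl) = here refl
∈-labels⁺ {cs = (_ ⊨ _) ∷ _} (there p) = there (∈-labels⁺ p)
∈-labels⁺ {cs = rel _ _ _ ∷ _} (there p) = ∈-labels⁺ p

∈-labels⁻ : ∀ {ad a ψ} cs → (a , ψ) ∈ labels ad cs → ∃ λ z → (z ⊨ ψ) ∈ cs × ad z ≡ a
∈-labels⁻ ((z ⊨ _) ∷ _) (here refl) = z , here refl , refl
∈-labels⁻ ((_ ⊨ _) ∷ cs) (there p) with z , q , e ← ∈-labels⁻ cs p = z , there q , e
∈-labels⁻ (rel _ _ _ ∷ cs) p with z , q , e ← ∈-labels⁻ cs p = z , there q , e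

module Measure (φ : Formula) where

  open Missing (≡-dec-× _≟ₐ_ _≟ᶠ_)

  M : ℕ
  M = md φ

  Admissible : ℕ → Formula → Set
  Admissible d χ = Cl φ χ × md χ + d ≤ M

  slots : List Slot
  slots = concatMap slotsOf (closure φ)

  universe : ℕ → List (Address × Formula)
  universe d = cartesianProduct (lists d slots) (closure φ)

  μ : State → (ℕ → Address) → Vec ℕ (suc M)
  μ S ad = profile (suc M) (λ d → missing (universe d) (labels ad (cs S)))

  record Child (S : State) (ad : ℕ → Address) (a b : ℕ) : Set where
    constructor child
    field
      ω : Inter
      n : ℕ
      ψ : Formula
      i : ℕ
      address : ad b ≡ (⟨ ω ⟩≥ n ∙ ψ , i) ∷ ad a
      labelled : (b ⊨ ψ) ∈ cs S
      related : ∀ R → R ∈ toList ω → rel R a b ∈ cs S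

  record Invariant (S : State) (ad : ℕ → Address) : Set where
    field
      admissible : ∀ {z ψ} → (z ⊨ ψ) ∈ cs S → Admissible (length (ad z)) ψ
      address-slots : ∀ {z} → Labelled S z → All (_∈ slots) (ad z)
      address-injective : ∀ {z z′} → Labelled S z → Labelled S z′ → ad z ≡ ad z′ → z ≡ z′
      edge-child : ∀ {a b} → a ≺[ S ] b → Child S ad a b
      parent : ∀ {z s a} → Labelled S z → ad z ≡ s ∷ a → ∃ λ p → p ≺[ S ] z × Labelled S p
      rel-edge : ∀ {R a b} → rel R a b ∈ cs S → a ≺[ S ] b ⊎ b ≺[ S ] a
      mentioned-labelled : ∀ {c z} → c ∈ cs S → Mentions c z → Labelled S z

  open Invariant

  ≺-deeper : ∀ {S ad a b} → Invariant S ad → a ≺[ S ] b → length (ad b) ≡ suc (length (ad a))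
  ≺-deeper inv a≺b = cong length (Child.address (edge-child inv a≺b))

  ≺⁺-deeper : ∀ {S ad a b} → Invariant S ad → a ≺⁺[ S ] b → length (ad a) < length (ad b)
  ≺⁺-deeper inv TransClosure.[ a≺b ] = ≤-reflexive (sym (≺-deeper inv a≺b))
  ≺⁺-deeper inv (a≺c ∷ c≺⁺b) =
    <-trans (≤-reflexive (sym (≺-deeper inv a≺c))) (≺⁺-deeper inv c≺⁺b)

  ∈-universe-level : ∀ {d a ψ} → (a , ψ) ∈ universe d → length a ≡ d
  ∈-universe-level {d} u∈ = ∈-lists⁻ d (proj₁ (∈-cartesianProduct⁻ (lists d slots) (closure φ) u∈))

  labels-⊆ : ∀ {S T ad ad′ d} →
    (∀ {z ψ} → (z ⊨ ψ) ∈ cs S → length (ad z) ≡ d → (z ⊨ ψ) ∈ cs T × ad′ z ≡ ad z) →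
    labels ad (cs S) ⊆ labels ad′ (cs T) on universe d
  labels-⊆ {S} {T} {ad′ = ad′} transfer {a , ψ} u∈ l∈
    with z , z⊨ψ , refl ← ∈-labels⁻ (cs S) l∈ =
    let z⊨ψ′ , same = transfer z⊨ψ (∈-universe-level u∈)
    in subst (λ b → (b , ψ) ∈ labels ad′ (cs T)) same (∈-labels⁺ z⊨ψ′)

  μ-decreases : ∀ {S T ad ad′} → Invariant T ad′ → ∀ {x χ} → (x ⊨ χ) ∈ cs T →
    (∀ {z ψ} → (z ⊨ ψ) ∈ cs S → length (ad z) ≤ length (ad′ x) →
      (z ⊨ ψ) ∈ cs T × ad′ z ≡ ad z) →
    (∀ {z ψ} → (z ⊨ ψ) ∈ cs T → length (ad′ z) < length (ad′ x) →
      (z ⊨ ψ) ∈ cs S × ad z ≡ ad′ z) →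
    ¬ LabelledAt S ad (ad′ x) χ →
    μ T ad′ <ₗₑₓ μ S ad
  μ-decreases {S} {T} {ad} {ad′} inv {x} {χ} x⊨χ persists recalls fresh =
    profile-<ₗₑₓ L (s≤s L≤M) agree-below
      (missing-< (universe L) (kept ≤-refl) new∈universe (∈-labels⁺ x⊨χ) (fresh ∘ ∈-labels⁻ (cs S)))
    where
    L = length (ad′ x)
    L≤M : L ≤ M
    L≤M = ≤-trans (m≤n+m L (md χ)) (proj₂ (admissible inv x⊨χ))
    new∈universe : (ad′ x , χ) ∈ universe L
    new∈universe =
      ∈-cartesianProduct⁺ (∈-lists⁺ (address-slots inv (_ , x⊨χ)))
                          (Cl⇒∈closure (proj₁ (admissible inv x⊨χ)))
    kept : ∀ {d} → d ≤ L → labels ad (cs S) ⊆ labels ad′ (cs T) on universe d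
    kept d≤L = labels-⊆ {S} {T} (λ z⊨ψ level-d → persists z⊨ψ (subst (_≤ L) (sym level-d) d≤L))
    recalled : ∀ {d} → d < L → labels ad′ (cs T) ⊆ labels ad (cs S) on universe d
    recalled d<L = labels-⊆ {T} {S} (λ z⊨ψ level-d → recalls z⊨ψ (subst (_< L) (sym level-d) d<L))
    agree-below : ∀ d → d < L →
      missing (universe d) (labels ad′ (cs T)) ≡ missing (universe d) (labels ad (cs S))
    agree-below d d<L = missing-cong (universe d) (kept (<⇒≤ d<L)) (recalled d<L)

  Progress : State → State → (ℕ → Address) → Set
  Progress S T ad = ∃ λ ad′ → Invariant T ad′ × μ T ad′ <ₗₑₓ μ S ad

  admissible-≤ : ∀ {d d′ χ} → d ≤ d′ → Admissible d′ χ → Admissible d χ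
  admissible-≤ {χ = χ} d≤d′ (cl , depth) = cl , ≤-trans (+-monoʳ-≤ (md χ) d≤d′) depth

  component-admissible : ∀ {d χ θ} → Component χ θ → Admissible d θ → Admissible d χ
  component-admissible {d} k (cl , depth) = Cl-component k cl , ≤-trans (+-monoˡ-≤ d (md-component k)) depth

  scope-admissible : ∀ {d ψ θ χ} → ScopeOf ψ θ → Admissible d θ →
    χ ≡ ψ ⊎ χ ≡ ∼ ψ → Admissible (suc d) χ
  scope-admissible {d} {ψ} s (cl , depth) χ≡ = choice χ≡
    where
    depth′ : md ψ + suc d ≤ M
    depth′ = ≤-trans (≤-reflexive (trans (+-suc (md ψ) d) (cong (_+ d) (sym (md-scope s))))) depth
    choice : ∀ {χ} → χ ≡ ψ ⊎ χ ≡ ∼ ψ → Admissible (suc d) χ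
    choice (inj₁ refl) = sub∈ (Cl-scope s cl) , depth′
    choice (inj₂ refl) = Cl-∼ (Cl-scope s cl) , ≤-trans (+-monoˡ-≤ (suc d) (md-∼ ψ)) depth′

  NewLabel : State → State → ℕ → Set
  NewLabel S T x = ∃ λ χ → (x ⊨ χ) ∈ cs T × (x ⊨ χ) ∉ cs S

  record Relabelling (S T : State) (ad : ℕ → Address) (x : ℕ) : Set₁ where
    field
      Pruned : ℕ → Set
      pruned-deeper : ∀ {z} → Pruned z → length (ad x) < length (ad z)
      pruned-closed : ∀ {a b} → a ≺[ S ] b → Pruned a → Pruned b
      cs-⊆ : ∀ {c} → c ∈ cs T →
        (c ∈ cs S × ¬ MentionsSome Pruned c) ⊎ (∃ λ χ → c ≡ (x ⊨ χ) × Admissible (length (ad x)) χ)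
      cs-⊇ : ∀ {c} → c ∈ cs S → ¬ MentionsSome Pruned c → c ∈ cs T
      prec-⊆ : ∀ {a b} → a ≺[ T ] b → a ≺[ S ] b × ¬ Pruned a × ¬ Pruned b
      prec-⊇ : ∀ {a b} → a ≺[ S ] b → ¬ Pruned a → ¬ Pruned b → a ≺[ T ] b

  module _ {S T : State} {ad : ℕ → Address} {x : ℕ}
           (inv : Invariant S ad) (x-labelled : Labelled S x) (r : Relabelling S T ad x) where
    open Relabelling r

    private
      unpruned-labelled : ∀ {z} → Labelled T z → Labelled S z × ¬ Pruned z
      unpruned-labelled (ψ , z⊨ψ) with cs-⊆ z⊨ψ
      ... | inj₁ (z⊨ψ′ , unmentioned) = (ψ , z⊨ψ′) , λ pruned → unmentioned (_ , sat , pruned)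
      ... | inj₂ (_ , refl , _) = x-labelled , λ pruned → <-irrefl refl (pruned-deeper pruned)

      labelled-forth : ∀ {z} → Labelled S z → ¬ Pruned z → Labelled T z
      labelled-forth (ψ , z⊨ψ) unpruned = ψ , cs-⊇ z⊨ψ (unpruned ∘ mentions-⊨)

      child-forth : ∀ {a b} → Child S ad a b → ¬ Pruned a → ¬ Pruned b → Child T ad a b
      child-forth (child ω n ψ i address b⊨ψ related) a-unpruned b-unpruned =
        child ω n ψ i address (cs-⊇ b⊨ψ (b-unpruned ∘ mentions-⊨))
              (λ R R∈ω → cs-⊇ (related R R∈ω) ([ a-unpruned , b-unpruned ] ∘ mentions-rel))

      parent′ : ∀ {z s a} → Labelled T z → ad z ≡ s ∷ a → ∃ λ p → p ≺[ T ] z × Labelled T p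
      parent′ z-labelled at with z-labelledˢ , z-unpruned ← unpruned-labelled z-labelled
                            with p , p≺z , p-labelled ← parent inv z-labelledˢ at =
        p , prec-⊇ p≺z p-unpruned z-unpruned , labelled-forth p-labelled p-unpruned
        where
        p-unpruned = z-unpruned ∘ pruned-closed p≺z

      rel-edge′ : ∀ {R a b} → rel R a b ∈ cs T → a ≺[ T ] b ⊎ b ≺[ T ] a
      rel-edge′ Rab with cs-⊆ Rab
      ... | inj₁ (Rabˢ , unmentioned) =
        Data.Sum.map (λ a≺b → prec-⊇ a≺b a-unpruned b-unpruned)
                     (λ b≺a → prec-⊇ b≺a b-unpruned a-unpruned)
                     (rel-edge inv Rabˢ)
        where
        a-unpruned = λ pruned → unmentioned (_ , relˡ , pruned)
        b-unpruned = λ pruned → unmentioned (_ , relʳ , pruned)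

      mentioned-labelled′ : ∀ {c z} → c ∈ cs T → Mentions c z → Labelled T z
      mentioned-labelled′ c∈ mentions with cs-⊆ c∈
      ... | inj₁ (c∈ˢ , unmentioned) =
        labelled-forth (mentioned-labelled inv c∈ˢ mentions) (λ pruned → unmentioned (_ , mentions , pruned))
      mentioned-labelled′ c∈ sat | inj₂ (_ , refl , _) = _ , c∈

    relabel-invariant : Invariant T ad
    relabel-invariant = record
      { admissible = admissible′
      ; address-slots = address-slots inv ∘ proj₁ ∘ unpruned-labelled
      ; address-injective = λ z z′ →
          address-injective inv (proj₁ (unpruned-labelled z)) (proj₁ (unpruned-labelled z′))
      ; edge-child = λ a≺b → let a≺ˢb , a-unpruned , b-unpruned = prec-⊆ a≺b
                             in child-forth (edge-child inv a≺ˢb) a-unpruned b-unpruned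
      ; parent = parent′
      ; rel-edge = rel-edge′
      ; mentioned-labelled = mentioned-labelled′
      }
      where
      admissible′ : ∀ {z ψ} → (z ⊨ ψ) ∈ cs T → Admissible (length (ad z)) ψ
      admissible′ z⊨ψ with cs-⊆ z⊨ψ
      ... | inj₁ (z⊨ψ′ , _) = admissible inv z⊨ψ′
      ... | inj₂ (_ , refl , adm) = adm

    relabel-progress : NewLabel S T x → Progress S T ad
    relabel-progress (χ , x⊨χ , x⊭χ) =
      ad , relabel-invariant , μ-decreases {S} relabel-invariant x⊨χ persists recalls fresh
      where
      persists : ∀ {z ψ} → (z ⊨ ψ) ∈ cs S → length (ad z) ≤ length (ad x) →
        (z ⊨ ψ) ∈ cs T × ad z ≡ ad z
      persists z⊨ψ shallow = cs-⊇ z⊨ψ (λ m → <⇒≱ (pruned-deeper (mentions-⊨ m)) shallow) , refl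
      recalls : ∀ {z ψ} → (z ⊨ ψ) ∈ cs T → length (ad z) < length (ad x) →
        (z ⊨ ψ) ∈ cs S × ad z ≡ ad z
      recalls z⊨ψ shallower with cs-⊆ z⊨ψ
      ... | inj₁ (z⊨ψ′ , _) = z⊨ψ′ , refl
      ... | inj₂ (_ , refl , _) = ⊥-elim (<-irrefl refl shallower)
      fresh : ¬ LabelledAt S ad (ad x) χ
      fresh (z , z⊨χ , same) =
        x⊭χ (subst (λ w → (w ⊨ χ) ∈ cs S) (address-injective inv (_ , z⊨χ) x-labelled same) z⊨χ)

  component-progress : ∀ {S T ad x θ} → Invariant S ad → (x ⊨ θ) ∈ cs S →
    (∀ {c} → c ∈ cs T → c ∈ cs S ⊎ ∃ λ χ → c ≡ (x ⊨ χ) × Component χ θ) →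
    (∀ {c} → c ∈ cs S → c ∈ cs T) → (∀ p → (p ∈ prec T) ⇔ (p ∈ prec S)) →
    NewLabel S T x → Progress S T ad
  component-progress {S} {T} {ad} {x} inv x⊨θ cs-⊆ cs-⊇ prec-≡ =
    relabel-progress inv (_ , x⊨θ) r
    where
    r : Relabelling S T ad x
    r .Relabelling.Pruned _ = ⊥
    r .Relabelling.pruned-deeper ()
    r .Relabelling.pruned-closed _ ()
    r .Relabelling.cs-⊆ c∈ with cs-⊆ c∈
    ... | inj₁ c∈ˢ = inj₁ (c∈ˢ , λ ())
    ... | inj₂ (χ , refl , k) = inj₂ (χ , refl , component-admissible k (admissible inv x⊨θ))
    r .Relabelling.cs-⊇ c∈ _ = cs-⊇ c∈
    r .Relabelling.prec-⊆ a≺b = to (prec-≡ _) a≺b , id , id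
    r .Relabelling.prec-⊇ a≺b _ _ = from (prec-≡ _) a≺b

  ∧-progress : ∀ {S T ad x a b} → Invariant S ad →
    (x ⊨ (a ∧ b)) ∈ cs S → ¬ (((x ⊨ a) ∈ cs S) × ((x ⊨ b) ∈ cs S)) →
    (∀ c → (c ∈ cs T) ⇔ ((c ∈ cs S) ⊎ (c ≡ (x ⊨ a)) ⊎ (c ≡ (x ⊨ b)))) →
    (∀ p → (p ∈ prec T) ⇔ (p ∈ prec S)) →
    Progress S T ad
  ∧-progress {S} {T} {x = x} {a} {b} inv x⊨a∧b incomplete csT precT =
    component-progress inv x⊨a∧b cs-⊆ (from (csT _) ∘ inj₁) precT new-conjunct
    where
    cs-⊆ : ∀ {c} → c ∈ cs T → c ∈ cs S ⊎ ∃ λ χ → c ≡ (x ⊨ χ) × Component χ (a ∧ b)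
    cs-⊆ c∈ with to (csT _) c∈
    ... | inj₁ c∈ˢ = inj₁ c∈ˢ
    ... | inj₂ (inj₁ refl) = inj₂ (a , refl , ∧ˡ)
    ... | inj₂ (inj₂ refl) = inj₂ (b , refl , ∧ʳ)
    new-conjunct : NewLabel S T x
    new-conjunct with (x ⊨ a) ∈? cs S
    ... | no x⊭a = a , from (csT _) (inj₂ (inj₁ refl)) , x⊭a
    ... | yes x⊨a = b , from (csT _) (inj₂ (inj₂ refl)) , λ x⊨b → incomplete (x⊨a , x⊨b)

  ∨-progress : ∀ {S T ad x a b χ} → Invariant S ad →
    (x ⊨ (a ∨ b)) ∈ cs S → (x ⊨ a) ∉ cs S → (x ⊨ b) ∉ cs S → (χ ≡ a ⊎ χ ≡ b) →
    (∀ c → (c ∈ cs T) ⇔ ((c ∈ cs S) ⊎ (c ≡ (x ⊨ χ)))) →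
    (∀ p → (p ∈ prec T) ⇔ (p ∈ prec S)) →
    Progress S T ad
  ∨-progress {S} {T} {x = x} {a} {b} {χ} inv x⊨a∨b x⊭a x⊭b χ≡ csT precT =
    component-progress inv x⊨a∨b cs-⊆ (from (csT _) ∘ inj₁) precT
      (χ , from (csT _) (inj₂ refl) , x⊭χ χ≡)
    where
    disjunct : ∀ {χ} → χ ≡ a ⊎ χ ≡ b → Component χ (a ∨ b)
    disjunct (inj₁ refl) = ∨ˡ
    disjunct (inj₂ refl) = ∨ʳ
    x⊭χ : ∀ {χ} → χ ≡ a ⊎ χ ≡ b → (x ⊨ χ) ∉ cs S
    x⊭χ (inj₁ refl) = x⊭a
    x⊭χ (inj₂ refl) = x⊭b
    cs-⊆ : ∀ {c} → c ∈ cs T → c ∈ cs S ⊎ ∃ λ χ′ → c ≡ (x ⊨ χ′) × Component χ′ (a ∨ b)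
    cs-⊆ c∈ with to (csT _) c∈
    ... | inj₁ c∈ˢ = inj₁ c∈ˢ
    ... | inj₂ refl = inj₂ (χ , refl , disjunct χ≡)

  modal-scope : ∀ {S x ω n ψ} → Modal∈ S x ω n ψ → ∃ λ θ → ScopeOf ψ θ × (x ⊨ θ) ∈ cs S
  modal-scope (inj₁ x⊨θ) = _ , ≥-scope , x⊨θ
  modal-scope (inj₂ x⊨θ) = _ , ≤-scope , x⊨θ

  choose-progress : ∀ {S T ad x y ψ χ} → Invariant S ad →
    ChooseCond S x y ψ → (χ ≡ ψ ⊎ χ ≡ (∼ ψ)) →
    (∀ c → (c ∈ cs T) ⇔
      (((c ∈ cs S) × ¬ (Σ ℕ λ z → Mentions c z × y ≺⁺[ S ] z)) ⊎ (c ≡ (y ⊨ χ)))) →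
    (∀ a b → ((a , b) ∈ prec T) ⇔ (((a , b) ∈ prec S) × ¬ (y ≺⁺[ S ] a) × ¬ (y ≺⁺[ S ] b))) →
    Progress S T ad
  choose-progress {S} {T} {ad} {x} {y} {ψ} {χ} inv (_ , _ , _ , modal , _ , Rxy , y⊭ψ , y⊭∼ψ)
                  χ≡ csT precT =
    relabel-progress inv (mentioned-labelled inv Rxy relʳ) r (χ , from (csT _) (inj₂ refl) , y⊭χ χ≡)
    where
    y⊭χ : ∀ {χ} → χ ≡ ψ ⊎ χ ≡ ∼ ψ → (y ⊨ χ) ∉ cs S
    y⊭χ (inj₁ refl) = y⊭ψ
    y⊭χ (inj₂ refl) = y⊭∼ψ
    y-depth : length (ad y) ≤ suc (length (ad x))
    y-depth with rel-edge inv Rxy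
    ... | inj₁ x≺y = ≤-reflexive (≺-deeper inv x≺y)
    ... | inj₂ y≺x = m≤n⇒m≤1+n (≤-trans (n≤1+n _) (≤-reflexive (sym (≺-deeper inv y≺x))))
    χ-admissible : Admissible (length (ad y)) χ
    χ-admissible with _ , s , x⊨θ ← modal-scope {S} modal =
      admissible-≤ y-depth (scope-admissible s (admissible inv x⊨θ) χ≡)
    r : Relabelling S T ad y
    r .Relabelling.Pruned z = y ≺⁺[ S ] z
    r .Relabelling.pruned-deeper = ≺⁺-deeper inv
    r .Relabelling.pruned-closed a≺b y≺⁺a = y≺⁺a ∷ʳ a≺b
    r .Relabelling.cs-⊆ c∈ with to (csT _) c∈
    ... | inj₁ kept = inj₁ kept
    ... | inj₂ refl = inj₂ (χ , refl , χ-admissible)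
    r .Relabelling.cs-⊇ c∈ unmentioned = from (csT _) (inj₁ (c∈ , unmentioned))
    r .Relabelling.prec-⊆ a≺b = to (precT _ _) a≺b
    r .Relabelling.prec-⊇ a≺b a-kept b-kept = from (precT _ _) (a≺b , a-kept , b-kept)

  slot-occupant : ∀ {S ad x z ω n ψ i} → Invariant S ad → Labelled S x → Labelled S z →
    ad z ≡ (⟨ ω ⟩≥ n ∙ ψ , i) ∷ ad x →
    ((R : Role) → R ∈ toList ω → rel R x z ∈ cs S) × (z ⊨ ψ) ∈ cs S
  slot-occupant inv x-labelled z-labelled at-slot
    with p , p≺z , p-labelled ← parent inv z-labelled at-slot
    with child _ _ _ _ at-child z⊨ψ related ← edge-child inv p≺z
    with refl , same-parent ← ∷-injective (trans (sym at-slot) at-child)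
    with refl ← address-injective inv x-labelled p-labelled same-parent = related , z⊨ψ

  record Expansion (S T : State) (ad : ℕ → Address) (x y : ℕ) : Set where
    field
      ω : Inter
      n : ℕ
      ψ : Formula
      i : ℕ
      slot-valid : (⟨ ω ⟩≥ n ∙ ψ , i) ∈ slots
      slot-free : ∀ {z} → Labelled S z → ¬ ad z ≡ (⟨ ω ⟩≥ n ∙ ψ , i) ∷ ad x
      y-fresh : Fresh S y
      y⊨ψ : (y ⊨ ψ) ∈ cs T
      related : ∀ R → R ∈ toList ω → rel R x y ∈ cs T
      cs-⊆ : ∀ {c} → c ∈ cs T →
        c ∈ cs S ⊎ (∃ λ χ → c ≡ (y ⊨ χ) × Admissible (suc (length (ad x))) χ)
                 ⊎ (∃ λ R → c ≡ rel R x y ⊎ c ≡ rel R y x)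
      cs-⊇ : ∀ {c} → c ∈ cs S → c ∈ cs T
      prec-⊆ : ∀ {a b} → a ≺[ T ] b → a ≺[ S ] b ⊎ (a , b) ≡ (x , y)
      prec-⊇ : ∀ {a b} → a ≺[ S ] b → a ≺[ T ] b
      x≺y : x ≺[ T ] y

  child-transport : ∀ {S T ad ad′ a b} →
    (∀ {c} → c ∈ cs S → c ∈ cs T) → ad′ a ≡ ad a → ad′ b ≡ ad b →
    Child S ad a b → Child T ad′ a b
  child-transport cs-⊇ a-same b-same (child ω n ψ i at b⊨ψ related) =
    child ω n ψ i (trans b-same (trans at (cong (_ ∷_) (sym a-same))))
          (cs-⊇ b⊨ψ) (λ R R∈ω → cs-⊇ (related R R∈ω))

  module _ {S T : State} {ad : ℕ → Address} {x y : ℕ}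
           (inv : Invariant S ad) (x-labelled : Labelled S x) (e : Expansion S T ad x y) where
    open Expansion e

    private
      address : Address
      address = (⟨ ω ⟩≥ n ∙ ψ , i) ∷ ad x

      ad′ : ℕ → Address
      ad′ = ad [ y ≔ address ]

      ad′-old : ∀ {z} → Labelled S z → ad′ z ≡ ad z
      ad′-old (_ , z⊨χ) = [≔]-elsewhere ad address λ { refl → proj₁ y-fresh _ z⊨χ sat }

      ad′-new : ad′ y ≡ address
      ad′-new = [≔]-here ad y address

      label-back : ∀ {z χ} → (z ⊨ χ) ∈ cs T →
        (z ⊨ χ) ∈ cs S ⊎ (z ≡ y × Admissible (length (ad′ z)) χ)
      label-back z⊨χ with cs-⊆ z⊨χ
      ... | inj₁ z⊨χˢ = inj₁ z⊨χˢ
      ... | inj₂ (inj₁ (_ , refl , adm)) =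
        inj₂ (refl , subst (λ a → Admissible (length a) _) (sym ad′-new) adm)
      ... | inj₂ (inj₂ (_ , inj₁ ()))
      ... | inj₂ (inj₂ (_ , inj₂ ()))

      labelled-back : ∀ {z} → Labelled T z → Labelled S z ⊎ z ≡ y
      labelled-back (χ , z⊨χ) = Data.Sum.map (χ ,_) proj₁ (label-back z⊨χ)

      labelled-forth : ∀ {z} → Labelled S z → Labelled T z
      labelled-forth (χ , z⊨χ) = χ , cs-⊇ z⊨χ

      admissible′ : ∀ {z χ} → (z ⊨ χ) ∈ cs T → Admissible (length (ad′ z)) χ
      admissible′ z⊨χ with label-back z⊨χ
      ... | inj₁ z⊨χˢ =
        subst (λ a → Admissible (length a) _) (sym (ad′-old (_ , z⊨χˢ))) (admissible inv z⊨χˢ)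
      ... | inj₂ (_ , adm) = adm

      address-slots′ : ∀ {z} → Labelled T z → All (_∈ slots) (ad′ z)
      address-slots′ z-labelled with labelled-back z-labelled
      ... | inj₁ z-labelledˢ =
        subst (All (_∈ slots)) (sym (ad′-old z-labelledˢ)) (address-slots inv z-labelledˢ)
      ... | inj₂ refl = subst (All (_∈ slots)) (sym ad′-new) (slot-valid ∷ address-slots inv x-labelled)

      address-injective′ : ∀ {z z′} → Labelled T z → Labelled T z′ → ad′ z ≡ ad′ z′ → z ≡ z′
      address-injective′ z-labelled z′-labelled same
        with labelled-back z-labelled | labelled-back z′-labelled
      ... | inj₁ zˢ | inj₁ z′ˢ =
        address-injective inv zˢ z′ˢ (trans (sym (ad′-old zˢ)) (trans same (ad′-old z′ˢ)))
      ... | inj₂ refl | inj₂ refl = refl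
      ... | inj₁ zˢ | inj₂ refl = ⊥-elim (slot-free zˢ (trans (sym (ad′-old zˢ)) (trans same ad′-new)))
      ... | inj₂ refl | inj₁ z′ˢ =
        ⊥-elim (slot-free z′ˢ (trans (sym (ad′-old z′ˢ)) (trans (sym same) ad′-new)))

      edge-child′ : ∀ {a b} → a ≺[ T ] b → Child T ad′ a b
      edge-child′ a≺b with prec-⊆ a≺b
      ... | inj₁ a≺ˢb =
        let a≢y , b≢y = proj₂ y-fresh _ _ a≺ˢb
        in child-transport cs-⊇ ([≔]-elsewhere ad address a≢y) ([≔]-elsewhere ad address b≢y)
                           (edge-child inv a≺ˢb)
      ... | inj₂ refl = child ω n ψ i (trans ad′-new (cong (_ ∷_) (sym (ad′-old x-labelled)))) y⊨ψ related

      parent′ : ∀ {z s a} → Labelled T z → ad′ z ≡ s ∷ a → ∃ λ p → p ≺[ T ] z × Labelled T p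
      parent′ z-labelled at with labelled-back z-labelled
      ... | inj₁ zˢ = let p , p≺z , p-labelled = parent inv zˢ (trans (sym (ad′-old zˢ)) at)
                      in p , prec-⊇ p≺z , labelled-forth p-labelled
      ... | inj₂ refl = x , x≺y , labelled-forth x-labelled

      rel-edge′ : ∀ {R a b} → rel R a b ∈ cs T → a ≺[ T ] b ⊎ b ≺[ T ] a
      rel-edge′ Rab with cs-⊆ Rab
      ... | inj₁ Rabˢ = Data.Sum.map prec-⊇ prec-⊇ (rel-edge inv Rabˢ)
      ... | inj₂ (inj₁ (_ , () , _))
      ... | inj₂ (inj₂ (_ , inj₁ refl)) = inj₁ x≺y
      ... | inj₂ (inj₂ (_ , inj₂ refl)) = inj₂ x≺y

      mentioned-labelled′ : ∀ {c z} → c ∈ cs T → Mentions c z → Labelled T z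
      mentioned-labelled′ c∈ m with cs-⊆ c∈
      ... | inj₁ c∈ˢ = labelled-forth (mentioned-labelled inv c∈ˢ m)
      mentioned-labelled′ c∈ sat | inj₂ (inj₁ (_ , refl , _)) = _ , c∈
      mentioned-labelled′ c∈ relˡ | inj₂ (inj₂ (_ , inj₁ refl)) = labelled-forth x-labelled
      mentioned-labelled′ c∈ relʳ | inj₂ (inj₂ (_ , inj₁ refl)) = ψ , y⊨ψ
      mentioned-labelled′ c∈ relˡ | inj₂ (inj₂ (_ , inj₂ refl)) = ψ , y⊨ψ
      mentioned-labelled′ c∈ relʳ | inj₂ (inj₂ (_ , inj₂ refl)) = labelled-forth x-labelled

      expansion-invariant : Invariant T ad′
      expansion-invariant = record
        { admissible = admissible′
        ; address-slots = address-slots′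
        ; address-injective = address-injective′
        ; edge-child = edge-child′
        ; parent = parent′
        ; rel-edge = rel-edge′
        ; mentioned-labelled = mentioned-labelled′
        }

    expansion-progress : Progress S T ad
    expansion-progress =
      ad′ , expansion-invariant , μ-decreases {S} expansion-invariant y⊨ψ persists recalls fresh
      where
      persists : ∀ {z χ} → (z ⊨ χ) ∈ cs S → length (ad z) ≤ length (ad′ y) →
        (z ⊨ χ) ∈ cs T × ad′ z ≡ ad z
      persists z⊨χ _ = cs-⊇ z⊨χ , ad′-old (_ , z⊨χ)
      recalls : ∀ {z χ} → (z ⊨ χ) ∈ cs T → length (ad′ z) < length (ad′ y) →
        (z ⊨ χ) ∈ cs S × ad z ≡ ad′ z
      recalls z⊨χ shallower with label-back z⊨χ
      ... | inj₁ z⊨χˢ = z⊨χˢ , sym (ad′-old (_ , z⊨χˢ))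
      ... | inj₂ (refl , _) = ⊥-elim (<-irrefl refl shallower)
      fresh : ¬ LabelledAt S ad (ad′ y) ψ
      fresh (z , z⊨ψ , at) = slot-free (_ , z⊨ψ) (trans at ad′-new)

  slot∈slots : ∀ {ω n ψ i} → Cl φ (⟨ ω ⟩≥ n ∙ ψ) → i < n → (⟨ ω ⟩≥ n ∙ ψ , i) ∈ slots
  slot∈slots cl i<n = ∈-concat⁺′ (∈-map⁺ _ (∈-upTo⁺ i<n)) (∈-map⁺ slotsOf (Cl⇒∈closure cl))

  ≥-progress : ∀ {S T ad x ω n ψ} → Invariant S ad →
    (x ⊨ (⟨ ω ⟩≥ n ∙ ψ)) ∈ cs S → (Σ ℕ λ k → Counted S ω x ψ k × k < n) →
    (y : ℕ) → Fresh S y → (ch : Formula → Bool) →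
    (Rs : List Role) → (∀ R → R ∈ toList ω → R ∈ Rs) →
    (∀ c → (c ∈ cs T) ⇔
      ((c ∈ cs S) ⊎ (c ≡ (y ⊨ ψ))
       ⊎ (Σ Formula λ ψ′ → InScope S x ψ′ × c ≡ (y ⊨ (if ch ψ′ then ψ′ else ∼ ψ′)))
       ⊎ (Σ Role λ R → R ∈ Rs × (c ≡ rel R x y ⊎ c ≡ rel (R ⁻¹) y x)))) →
    (∀ p → (p ∈ prec T) ⇔ ((p ∈ prec S) ⊎ p ≡ (x , y))) →
    Progress S T ad
  ≥-progress {S} {T} {ad} {x} {ω} {n} {ψ} inv x⊨θ (_ , (ys , _ , refl , counted) , |ys|<n)
             y y-fresh ch Rs ω⊆Rs csT precT =
    expansion-progress inv (_ , x⊨θ) e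
    where
    AtSlot : ℕ → ℕ → Set
    AtSlot i z = ad z ≡ (⟨ ω ⟩≥ n ∙ ψ , i) ∷ ad x
    free : ∃ λ i → i < n × ¬ Any (AtSlot i) ys
    free = unoccupied-index AtSlot (λ i z → ad z ≟ₐ _)
             (λ at at′ → ,-injectiveʳ (∷-injectiveˡ (trans (sym at) at′))) ys |ys|<n
    scoped-admissible : ∀ {ψ′} → InScope S x ψ′ → ∀ b →
      Admissible (suc (length (ad x))) (if b then ψ′ else ∼ ψ′)
    scoped-admissible {ψ′} (_ , _ , modal) b with _ , s , x⊨θ′ ← modal-scope {S} modal =
      scope-admissible s (admissible inv x⊨θ′) (if-choice b ψ′)
    e : Expansion S T ad x y
    e .Expansion.ω = ω
    e .Expansion.n = n
    e .Expansion.ψ = ψ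
    e .Expansion.i = proj₁ free
    e .Expansion.slot-valid = slot∈slots (proj₁ (admissible inv x⊨θ)) (proj₁ (proj₂ free))
    e .Expansion.slot-free z-labelled at =
      proj₂ (proj₂ free)
        (Any.map (λ { refl → at }) (from (counted _) (slot-occupant inv (_ , x⊨θ) z-labelled at)))
    e .Expansion.y-fresh = y-fresh
    e .Expansion.y⊨ψ = from (csT _) (inj₂ (inj₁ refl))
    e .Expansion.related R R∈ω = from (csT _) (inj₂ (inj₂ (inj₂ (R , ω⊆Rs R R∈ω , inj₁ refl))))
    e .Expansion.cs-⊆ c∈ with to (csT _) c∈
    ... | inj₁ c∈ˢ = inj₁ c∈ˢ
    ... | inj₂ (inj₁ refl) =
      inj₂ (inj₁ (ψ , refl , scope-admissible ≥-scope (admissible inv x⊨θ) (inj₁ refl)))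
    ... | inj₂ (inj₂ (inj₁ (ψ′ , scoped , refl))) =
      inj₂ (inj₁ (_ , refl , scoped-admissible scoped (ch ψ′)))
    ... | inj₂ (inj₂ (inj₂ (R , _ , inj₁ refl))) = inj₂ (inj₂ (R , inj₁ refl))
    ... | inj₂ (inj₂ (inj₂ (R , _ , inj₂ refl))) = inj₂ (inj₂ (R ⁻¹ , inj₂ refl))
    e .Expansion.cs-⊇ = from (csT _) ∘ inj₁
    e .Expansion.prec-⊆ = to (precT _)
    e .Expansion.prec-⊇ = from (precT _) ∘ inj₁
    e .Expansion.x≺y = from (precT _) (inj₂ refl)

  step-progress : ∀ {S T ad} → Invariant S ad → Step S T → Progress S T ad
  step-progress inv (∧-rule _ _ _ x⊨a∧b incomplete csT precT) = ∧-progress inv x⊨a∧b incomplete csT precT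
  step-progress inv (∨-rule _ _ _ _ x⊨a∨b x⊭a x⊭b χ≡ csT precT) =
    ∨-progress inv x⊨a∨b x⊭a x⊭b χ≡ csT precT
  step-progress inv (choose-rule _ _ _ _ cond χ≡ csT precT) = choose-progress inv cond χ≡ csT precT
  step-progress inv (≥-rule _ _ _ _ x⊨θ deficit _ _ _ y y-fresh ch Rs ω⊆Rs csT precT) =
    ≥-progress inv x⊨θ deficit y y-fresh ch Rs ω⊆Rs csT precT

  root : ℕ → Address
  root _ = []

  initial-invariant : Invariant (initial φ) root
  initial-invariant = record
    { admissible = λ { (here refl) → sub∈ ⊑-refl , ≤-reflexive (+-identityʳ M) ; (there ()) }
    ; address-slots = λ _ → []
    ; address-injective = λ { (_ , here refl) (_ , here refl) _ → refl ; (_ , there ()) _ _ ; _ (_ , there ()) _ }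
    ; edge-child = λ ()
    ; parent = λ _ ()
    ; rel-edge = λ { (here ()) ; (there ()) }
    ; mentioned-labelled = λ { (here refl) sat → _ , here refl ; (there ()) _ }
    }

lemma6 : (φ : Formula) → ¬ InfiniteRun (initial φ)
lemma6 φ (run , run₀ , steps) =
  no-infinite-descent <ₗₑₓ-wellFounded Ranked descend
    (root , subst (λ S → Invariant S root) (sym run₀) initial-invariant , refl)
  where
  open Measure φ
  Ranked : ℕ → Vec ℕ (suc M) → Set
  Ranked i v = ∃ λ ad → Invariant (run i) ad × μ (run i) ad ≡ v
  descend : ∀ {i v} → Ranked i v → ∃ λ w → Ranked (suc i) w × w <ₗₑₓ v
  descend (ad , inv , refl) with ad′ , inv′ , decrease ← step-progress inv (steps _) =
    _ , (ad′ , inv′ , refl) , decrease
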